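{- Let $(P,\leq,\cdot)$ be a right posemigroup and let $m\in P$ be minimal. For every $x\in P$, $m\cdot x\leq x$ and $m\cdot x$ is minimal in $P$.
   Context: A right posemigroup is a structure $(P,\leq,\cdot)$ where $(P,\leq)$ is a poset and $\cdot$ is a right-regular band operation on $P$ (associative, with $x\cdot x=x$ and $x\cdot y\cdot x=y\cdot x$) such that for all $x,y$: $x\leq y\iff x\cdot y=x$. -}

module Defs where

open import Level using (Level; suc; _⊔_)
open import Relation.Binary.PropositionalEquality using (_≡_)
open import Relation.Binary.Structures using (IsPartialOrder)
open import Relation.Binary.Bundles using (Poset)
open import Function.Bundles using (_⇔_)

record RightPosemigroup (c ℓ : Level) : Set (suc (c ⊔ ℓ)) where
  infixl 7 _·_
  infix 4 _≤_
  field
    Carrier        : Set c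
    _≤_            : Carrier → Carrier → Set ℓ
    isPartialOrder : IsPartialOrder _≡_ _≤_
    _·_            : Carrier → Carrier → Carrier
    assoc          : ∀ x y z → (x · y) · z ≡ x · (y · z)
    idem           : ∀ x → x · x ≡ x
    rightRegular   : ∀ x y → x · y · x ≡ y · x
    order-compat   : ∀ x y → (x ≤ y) ⇔ (x · y ≡ x)

  Minimal : Carrier → Set (c ⊔ ℓ)
  Minimal m = ∀ y → y ≤ m → y ≡ m

{-# OPTIONS --safe #-}
module Submission where

open import Defs
open import Level using (Level)
open import Data.Product using (_×_; _,_)
open import Relation.Binary.PropositionalEquality using (_≡_; sym; cong; module ≡-Reasoning)
open import Function.Bundles using (Equivalence)

module RightPosemigroupProperties {c ℓ : Level} (P : RightPosemigroup c ℓ) where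
  open RightPosemigroup P
  open Equivalence
  open ≡-Reasoning

  ≤⇒·≡ˡ : ∀ {x y} → x ≤ y → x · y ≡ x
  ≤⇒·≡ˡ {x} {y} = to (order-compat x y)

  ·≡ˡ⇒≤ : ∀ {x y} → x · y ≡ x → x ≤ y
  ·≡ˡ⇒≤ {x} {y} = from (order-compat x y)

  x·y≤y : ∀ x y → x · y ≤ y
  x·y≤y x y = ·≡ˡ⇒≤ (begin
    x · y · y    ≡⟨ assoc x y y ⟩
    x · (y · y)  ≡⟨ cong (x ·_) (idem y) ⟩
    x · y        ∎)

  minimal⇒y·m≡m : ∀ {m} → Minimal m → ∀ y → y · m ≡ m
  minimal⇒y·m≡m {m} min y = min (y · m) (x·y≤y y m)

  minimal-·ʳ : ∀ {m} → Minimal m → ∀ x → Minimal (m · x)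
  minimal-·ʳ {m} min x y y≤m·x = sym (begin
    m · x        ≡⟨ cong (_· x) (sym (minimal⇒y·m≡m min y)) ⟩
    y · m · x    ≡⟨ assoc y m x ⟩
    y · (m · x)  ≡⟨ ≤⇒·≡ˡ y≤m·x ⟩
    y            ∎)

corollary2p8 : ∀ {c ℓ : Level} (P : RightPosemigroup c ℓ)
    → let open RightPosemigroup P in
    ∀ (m : Carrier) → Minimal m
    → ∀ (x : Carrier) → (m · x ≤ x) × Minimal (m · x)
corollary2p8 P m min x = x·y≤y m x , minimal-·ʳ min x
  where open RightPosemigroupProperties P
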